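{- Let $q$ be a prime power, $r$ a prime with $q=q_0^r$, $n\ge2$, $V=\mathbb{F}_q^n$ with fixed basis $(v_1,\dots,v_n)$, and $V_0$ the $\mathbb{F}_{q_0}$-span of this basis. For $v=\sum_i\alpha_iv_i\in V\setminus\{0\}$ let $D_v=\langle\alpha_1,\dots,\alpha_n\rangle_{\mathbb{F}_{q_0}}$ and $c(v)=\dim_{\mathbb{F}_{q_0}}D_v$, and let $\mathcal{U}$ be the set of $\mathbb{F}_{q_0}$-linearly independent $c(v)$-tuples of vectors in $V_0$. Then for any fixed $\mathbb{F}_{q_0}$-basis $\{\beta_1,\dots,\beta_{c(v)}\}$ of $D_v$, the orbit of $v$ under $\mathrm{GL}(n,q_0)$ (matrices over $\mathbb{F}_{q_0}$ w.r.t. the fixed basis) is $v^{\mathrm{GL}(n,q_0)}=\{\sum_{i=1}^{c(v)}\beta_iu_i:(u_1,\dots,u_{c(v)})\in\mathcal{U}\}=\{u\in V\setminus\{0\}:D_u=D_v\}$. -}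

module Defs where

open import Data.Nat using (ℕ; zero; suc) renaming (_^_ to _^ℕ_)
open import Data.Nat.Primality using (Prime)
open import Data.Fin using (Fin; zero; suc)
open import Data.Bool using (Bool; T)
open import Data.Product using (Σ; ∃; ∃-syntax; Σ-syntax; _×_; _,_)
open import Relation.Nullary using (¬_)
open import Relation.Binary.PropositionalEquality using (_≡_)
open import Algebra.Structures using (IsCommutativeRing)
open import Function.Bundles using (_↔_; _⇔_)

IsPrimePower : ℕ → Set
IsPrimePower q = ∃[ p ] ∃[ k ] (Prime p × q ≡ p ^ℕ suc k)

record Field : Set₁ where
  infixl 6 _+_
  infixl 7 _*_
  field
    Carrier : Set
    _+_ _*_ : Carrier → Carrier → Carrier
    -_      : Carrier → Carrier
    0# 1#   : Carrier
    isCommutativeRing : IsCommutativeRing _≡_ _+_ _*_ -_ 0# 1#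
    0≢1     : ¬ (0# ≡ 1#)
    inverse : ∀ x → ¬ (x ≡ 0#) → ∃[ y ] (x * y ≡ 1#)

HasSize : Field → ℕ → Set
HasSize K q = Fin q ↔ Field.Carrier K

record Subfield (K : Field) : Set where
  open Field K
  field
    mem   : Carrier → Bool
    0∈    : T (mem 0#)
    1∈    : T (mem 1#)
    +∈    : ∀ {x y} → T (mem x) → T (mem y) → T (mem (x + y))
    *∈    : ∀ {x y} → T (mem x) → T (mem y) → T (mem (x * y))
    -∈    : ∀ {x} → T (mem x) → T (mem (- x))
    inv∈  : ∀ {x y} → T (mem x) → x * y ≡ 1# → T (mem y)

SubHasSize : {K : Field} → Subfield K → ℕ → Set
SubHasSize {K} F₀ q₀ = Fin q₀ ↔ Σ (Field.Carrier K) (λ x → T (Subfield.mem F₀ x))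

module VectorDefs (K : Field) (F₀ : Subfield K) where
  open Field K
  open Subfield F₀

  In₀ : Carrier → Set
  In₀ x = T (mem x)

  ∑ : ∀ {m} → (Fin m → Carrier) → Carrier
  ∑ {zero}  f = 0#
  ∑ {suc m} f = f zero + ∑ (λ i → f (suc i))

  -- V = 𝔽_q^n, vectors given by coordinates w.r.t. the fixed basis (v₁,…,vₙ)
  Vec : ℕ → Set
  Vec n = Fin n → Carrier

  _≋_ : ∀ {n} → Vec n → Vec n → Set
  u ≋ w = ∀ i → u i ≡ w i

  0V : ∀ {n} → Vec n
  0V _ = 0#

  InV₀ : ∀ {n} → Vec n → Set
  InV₀ u = ∀ i → In₀ (u i)

  InD : ∀ {n} → Vec n → Carrier → Set
  InD {n} v x = Σ[ λ′ ∈ (Fin n → Carrier) ] ((∀ i → In₀ (λ′ i)) × x ≡ ∑ {n} (λ i → λ′ i * v i))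

  SameD : ∀ {n} → Vec n → Vec n → Set
  SameD u v = ∀ x → InD u x ⇔ InD v x

  LinIndepK : ∀ {c} → (Fin c → Carrier) → Set
  LinIndepK {c} β = ∀ (λ′ : Fin c → Carrier) → (∀ i → In₀ (λ′ i)) →
    ∑ (λ i → λ′ i * β i) ≡ 0# → ∀ i → λ′ i ≡ 0#

  -- β₁,…,β_c is an 𝔽_{q₀}-basis of D_v (so c = c(v) = dim D_v)
  IsBasisD : ∀ {n c} → Vec n → (Fin c → Carrier) → Set
  IsBasisD {n} {c} v β =
    (∀ i → InD v (β i)) × LinIndepK β ×
    (∀ x → InD v x → Σ[ λ′ ∈ (Fin c → Carrier) ] ((∀ i → In₀ (λ′ i)) × x ≡ ∑ {c} (λ i → λ′ i * β i)))

  InU : ∀ {n c} → (Fin c → Vec n) → Set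
  InU {n} {c} us = (∀ k → InV₀ (us k)) ×
    (∀ (λ′ : Fin c → Carrier) → (∀ k → In₀ (λ′ k)) →
      (λ j → ∑ (λ k → λ′ k * us k j)) ≋ 0V → ∀ k → λ′ k ≡ 0#)

  combo : ∀ {n c} → (Fin c → Carrier) → (Fin c → Vec n) → Vec n
  combo β us j = ∑ (λ k → β k * us k j)

  Mat : ℕ → Set
  Mat n = Fin n → Fin n → Carrier

  _·_ : ∀ {n} → Mat n → Mat n → Mat n
  (g · h) i j = ∑ (λ k → g i k * h k j)

  I : ∀ {n} → Mat n
  I {suc n} zero    zero    = 1#
  I {suc n} zero    (suc j) = 0#
  I {suc n} (suc i) zero    = 0#
  I {suc n} (suc i) (suc j) = I {n} i j

  InMat₀ : ∀ {n} → Mat n → Set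
  InMat₀ g = ∀ i j → In₀ (g i j)

  InGL₀ : ∀ {n} → Mat n → Set
  InGL₀ {n} g = InMat₀ g × ∃[ h ] (InMat₀ h × (∀ i j → (g · h) i j ≡ I i j)
                                             × (∀ i j → (h · g) i j ≡ I i j))

  -- v^g : vᵢ ↦ ∑ⱼ gᵢⱼ vⱼ, so (∑ᵢ αᵢ vᵢ)^g has j-th coordinate ∑ᵢ αᵢ gᵢⱼ
  act : ∀ {n} → Vec n → Mat n → Vec n
  act v g j = ∑ (λ i → v i * g i j)

  InOrbit : ∀ {n} → Vec n → Vec n → Set
  InOrbit v u = ∃[ g ] (InGL₀ g × u ≋ act v g)

module Submission where

-- A matrix over F₀ replaces the coordinates of v by F₀-combinations of them, and so does its
-- inverse; hence D is constant on orbits. Conversely, if D_u = D_v, expanding the coordinates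
-- of u in the basis β writes u = Σ β_k u_k with u_k ∈ V₀, and the u_k are F₀-independent.
-- Column operations over F₀ (Gaussian elimination) send every F₀-independent c-tuple of V₀ to
-- the first c standard basis vectors, so GL(n,q₀) acts transitively on such tuples; as v itself
-- is Σ β_k u⁰_k, the element moving (u⁰_k) to (u_k) moves v to u.

open import Defs
open import Data.Nat using (ℕ; zero; suc; _≤_; z≤n; s≤s; _^_)
open import Data.Nat.Primality using (Prime)
open import Data.Fin using (Fin; zero; suc)
open import Data.Fin.Properties using (¬∀⟶∃¬-smallest; inj⇒≟)
open import Data.Vec.Functional using (tail)
open import Data.Product using (Σ; ∃-syntax; _×_; _,_; proj₁; proj₂)
open import Data.Empty using (⊥-elim)
open import Relation.Nullary using (¬_)
open import Relation.Binary.Definitions using (DecidableEquality)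
open import Relation.Binary.PropositionalEquality
open import Algebra.Bundles using (CommutativeRing)
open import Algebra.Structures using (IsCommutativeRing)
import Algebra.Properties.Ring as RingProperties
import Algebra.Properties.CommutativeSemigroup as CommutativeSemigroupProperties
open import Function using (id; _∘_)
open import Function.Bundles using (_⇔_; mk⇔; Equivalence)
open import Function.Properties.Inverse using (↔-sym; ↔⇒↣)

finite⇒decidableEquality : ∀ {q} (K : Field) → HasSize K q → DecidableEquality (Field.Carrier K)
finite⇒decidableEquality K size = inj⇒≟ (↔⇒↣ (↔-sym size))

module Orbits (K : Field) (F₀ : Subfield K) where
  open Field K
  open Subfield F₀
  open VectorDefs K F₀
  open IsCommutativeRing isCommutativeRing
    using ( +-assoc; +-comm; +-identityˡ; +-identityʳ; -‿inverseˡ; -‿inverseʳ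
          ; *-assoc; *-comm; *-identityˡ; *-identityʳ; distribˡ; distribʳ; zeroˡ; zeroʳ)
  open ≡-Reasoning

  private
    commutativeRing : CommutativeRing _ _
    commutativeRing = record { isCommutativeRing = isCommutativeRing }

  open RingProperties (CommutativeRing.ring commutativeRing)
    using (-‿involutive; -‿distribˡ-*; -‿distribʳ-*; -0#≈0#; -‿+-comm; x∙y⁻¹≈ε⇒x≈y)
  open CommutativeSemigroupProperties (CommutativeRing.+-commutativeSemigroup commutativeRing)
    using (interchange)
  open CommutativeSemigroupProperties (CommutativeRing.*-commutativeSemigroup commutativeRing)
    using (x∙yz≈y∙zx)

  ∑-cong : ∀ {m} {f g : Fin m → Carrier} → (∀ i → f i ≡ g i) → ∑ f ≡ ∑ g
  ∑-cong {zero}  f≗g = refl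
  ∑-cong {suc m} f≗g = cong₂ _+_ (f≗g zero) (∑-cong (f≗g ∘ suc))

  ∑-zero : ∀ {m} {f : Fin m → Carrier} → (∀ i → f i ≡ 0#) → ∑ f ≡ 0#
  ∑-zero {zero}  f≗0 = refl
  ∑-zero {suc m} f≗0 = trans (cong₂ _+_ (f≗0 zero) (∑-zero (f≗0 ∘ suc))) (+-identityˡ 0#)

  ∑-distrib-+ : ∀ {m} (f g : Fin m → Carrier) → ∑ (λ i → f i + g i) ≡ ∑ f + ∑ g
  ∑-distrib-+ {zero}  f g = sym (+-identityˡ 0#)
  ∑-distrib-+ {suc m} f g =
    trans (cong (f zero + g zero +_) (∑-distrib-+ (f ∘ suc) (g ∘ suc))) (interchange _ _ _ _)

  ∑-comm : ∀ {m p} (f : Fin m → Fin p → Carrier) →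
    ∑ (λ i → ∑ (f i)) ≡ ∑ (λ j → ∑ (λ i → f i j))
  ∑-comm {zero} {p} f = sym (∑-zero {p} (λ _ → refl))
  ∑-comm {suc m} f = trans (cong (∑ (f zero) +_) (∑-comm (f ∘ suc))) (sym (∑-distrib-+ (f zero) _))

  *-distribˡ-∑ : ∀ {m} a (f : Fin m → Carrier) → a * ∑ f ≡ ∑ (λ i → a * f i)
  *-distribˡ-∑ {zero}  a f = zeroʳ a
  *-distribˡ-∑ {suc m} a f = trans (distribˡ a _ _) (cong (a * f zero +_) (*-distribˡ-∑ a (f ∘ suc)))

  *-distribʳ-∑ : ∀ {m} a (f : Fin m → Carrier) → ∑ f * a ≡ ∑ (λ i → f i * a)
  *-distribʳ-∑ a f = trans (*-comm _ a) (trans (*-distribˡ-∑ a f) (∑-cong (λ i → *-comm a (f i))))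

  -‿distrib-∑ : ∀ {m} (f : Fin m → Carrier) → - ∑ f ≡ ∑ (λ i → - f i)
  -‿distrib-∑ {zero}  f = -0#≈0#
  -‿distrib-∑ {suc m} f = trans (sym (-‿+-comm _ _)) (cong (- f zero +_) (-‿distrib-∑ (f ∘ suc)))

  ∑-*-assoc : ∀ {p m} (a : Fin p → Carrier) (M : Fin p → Fin m → Carrier) (b : Fin m → Carrier) →
    ∑ (λ k → ∑ (λ j → a j * M j k) * b k) ≡ ∑ (λ j → a j * ∑ (λ k → M j k * b k))
  ∑-*-assoc a M b = begin
    ∑ (λ k → ∑ (λ j → a j * M j k) * b k)    ≡⟨ ∑-cong (λ k → *-distribʳ-∑ (b k) (λ j → a j * M j k)) ⟩
    ∑ (λ k → ∑ (λ j → a j * M j k * b k))    ≡⟨ ∑-comm (λ k j → a j * M j k * b k) ⟩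
    ∑ (λ j → ∑ (λ k → a j * M j k * b k))    ≡⟨ ∑-cong (λ j → ∑-cong (λ k → *-assoc (a j) (M j k) (b k))) ⟩
    ∑ (λ j → ∑ (λ k → a j * (M j k * b k)))  ≡⟨ ∑-cong (λ j → sym (*-distribˡ-∑ (a j) (λ k → M j k * b k))) ⟩
    ∑ (λ j → a j * ∑ (λ k → M j k * b k))    ∎

  ∑-Iˡ : ∀ {m} (k : Fin m) (f : Fin m → Carrier) → ∑ (λ i → I k i * f i) ≡ f k
  ∑-Iˡ zero    f = trans (cong₂ _+_ (*-identityˡ _) (∑-zero (λ i → zeroˡ (f (suc i))))) (+-identityʳ _)
  ∑-Iˡ (suc k) f = trans (cong₂ _+_ (zeroˡ _) (∑-Iˡ k (f ∘ suc))) (+-identityˡ _)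

  ∑-Iʳ : ∀ {m} (k : Fin m) (f : Fin m → Carrier) → ∑ (λ i → f i * I i k) ≡ f k
  ∑-Iʳ zero    f = trans (cong₂ _+_ (*-identityʳ _) (∑-zero (λ i → zeroʳ (f (suc i))))) (+-identityʳ _)
  ∑-Iʳ (suc k) f = trans (cong₂ _+_ (zeroʳ _) (∑-Iʳ k (f ∘ suc))) (+-identityˡ _)

  In₀-∑ : ∀ {m} {f : Fin m → Carrier} → (∀ i → In₀ (f i)) → In₀ (∑ f)
  In₀-∑ {zero}  f₀ = 0∈
  In₀-∑ {suc m} f₀ = +∈ (f₀ zero) (In₀-∑ (f₀ ∘ suc))

  In₀-I : ∀ {m} (i j : Fin m) → In₀ (I i j)
  In₀-I zero    zero    = 1∈
  In₀-I zero    (suc j) = 0∈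
  In₀-I (suc i) zero    = 0∈
  In₀-I (suc i) (suc j) = In₀-I i j

  ≋-sym : ∀ {n} {u w : Vec n} → u ≋ w → w ≋ u
  ≋-sym u≋w i = sym (u≋w i)

  ≋-trans : ∀ {n} {u v w : Vec n} → u ≋ v → v ≋ w → u ≋ w
  ≋-trans u≋v v≋w i = trans (u≋v i) (v≋w i)

  act-cong : ∀ {n} {u w : Vec n} (g : Mat n) → u ≋ w → act u g ≋ act w g
  act-cong g u≋w j = ∑-cong (λ i → cong (_* g i j) (u≋w i))

  act-· : ∀ {n} (v : Vec n) (g h : Mat n) → act v (g · h) ≋ act (act v g) h
  act-· v g h j = sym (∑-*-assoc v g (λ k → h k j))

  act-combo : ∀ {n c} (λ′ : Fin c → Carrier) (us : Fin c → Vec n) (g : Mat n) →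
    act (combo λ′ us) g ≋ combo λ′ (λ k → act (us k) g)
  act-combo λ′ us g j = ∑-*-assoc λ′ us (λ i → g i j)

  act-I : ∀ {n} (v : Vec n) → act v I ≋ v
  act-I v j = ∑-Iʳ j v

  act-row : ∀ {n} (i : Fin n) (g : Mat n) → act (I i) g ≋ g i
  act-row i g j = ∑-Iˡ i (λ k → g k j)

  act-0V : ∀ {n} (g : Mat n) → act 0V g ≋ 0V
  act-0V g j = ∑-zero (λ i → zeroˡ (g i j))

  act-inverse : ∀ {n} {g h : Mat n} → (∀ i j → (g · h) i j ≡ I i j) → ∀ v → act (act v g) h ≋ v
  act-inverse {g = g} {h} gh≡I v =
    ≋-trans (≋-sym (act-· v g h)) (≋-trans (λ j → ∑-cong (λ i → cong (v i *_) (gh≡I i j))) (act-I v))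

  ·-inverse : ∀ {n} {g h : Mat n} → (∀ v → act (act v g) h ≋ v) → ∀ i j → (g · h) i j ≡ I i j
  ·-inverse {g = g} {h} gh i j = begin
    (g · h) i j                ≡⟨ act-row i (g · h) j ⟨
    act (I i) (g · h) j        ≡⟨ act-· (I i) g h j ⟩
    act (act (I i) g) h j      ≡⟨ gh (I i) j ⟩
    I i j                      ∎

  InV₀-act : ∀ {n} {v : Vec n} {g : Mat n} → InV₀ v → InMat₀ g → InV₀ (act v g)
  InV₀-act v₀ g₀ j = In₀-∑ (λ i → *∈ (v₀ i) (g₀ i j))

  InMat₀-· : ∀ {n} {g h : Mat n} → InMat₀ g → InMat₀ h → InMat₀ (g · h)
  InMat₀-· g₀ h₀ i j = In₀-∑ (λ k → *∈ (g₀ i k) (h₀ k j))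

  -- Elements of GL(n, q₀) with a chosen inverse; invertibility is recorded on the action.
  record GL₀ (n : ℕ) : Set where
    field
      mat inv  : Mat n
      mat₀     : InMat₀ mat
      inv₀     : InMat₀ inv
      inverseˡ : ∀ v → act (act v mat) inv ≋ v
      inverseʳ : ∀ v → act (act v inv) mat ≋ v

  open GL₀

  InGL₀-mat : ∀ {n} (G : GL₀ n) → InGL₀ (mat G)
  InGL₀-mat G = mat₀ G , inv G , inv₀ G , ·-inverse (inverseˡ G) , ·-inverse (inverseʳ G)

  I₀ : ∀ {n} → GL₀ n
  I₀ = record
    { mat = I ; inv = I ; mat₀ = In₀-I ; inv₀ = In₀-I
    ; inverseˡ = λ v → ≋-trans (act-cong I (act-I v)) (act-I v)
    ; inverseʳ = λ v → ≋-trans (act-cong I (act-I v)) (act-I v)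
    }

  _⁻¹ : ∀ {n} → GL₀ n → GL₀ n
  G ⁻¹ = record
    { mat = inv G ; inv = mat G ; mat₀ = inv₀ G ; inv₀ = mat₀ G
    ; inverseˡ = inverseʳ G ; inverseʳ = inverseˡ G }

  infixl 7 _⨾_

  _⨾_ : ∀ {n} → GL₀ n → GL₀ n → GL₀ n
  G ⨾ H = record
    { mat = mat G · mat H ; inv = inv H · inv G
    ; mat₀ = InMat₀-· (mat₀ G) (mat₀ H) ; inv₀ = InMat₀-· (inv₀ H) (inv₀ G)
    ; inverseˡ = λ v → undo (mat G) (mat H) (inv H) (inv G) (inverseˡ H) (inverseˡ G) v
    ; inverseʳ = λ v → undo (inv H) (inv G) (mat G) (mat H) (inverseʳ G) (inverseʳ H) v
    }
    where
    undo : ∀ a b b′ a′ → (∀ v → act (act v b) b′ ≋ v) → (∀ v → act (act v a) a′ ≋ v) →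
      ∀ v → act (act v (a · b)) (b′ · a′) ≋ v
    undo a b b′ a′ bb′ aa′ v = ≋-trans (act-· _ b′ a′) (≋-trans
      (act-cong a′ (≋-trans (act-cong b′ (act-· v a b)) (bb′ (act v a)))) (aa′ v))

  act-⨾ : ∀ {n} (v : Vec n) (G H : GL₀ n) → act v (mat (G ⨾ H)) ≋ act (act v (mat G)) (mat H)
  act-⨾ v G H = act-· v (mat G) (mat H)

  InD-entry : ∀ {n} (w : Vec n) (j : Fin n) → InD w (w j)
  InD-entry w j = I j , In₀-I j , sym (∑-Iˡ j w)

  InD-act : ∀ {n} {v w : Vec n} {g : Mat n} {x : Carrier} → InMat₀ g → w ≋ act v g → InD w x → InD v x
  InD-act {v = v} {w} {g} {x} g₀ w≋vg (λ′ , λ′₀ , x≡) =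
    (λ j → ∑ (λ i → g j i * λ′ i)) , (λ j → In₀-∑ (λ i → *∈ (g₀ j i) (λ′₀ i))) , (begin
      x                                           ≡⟨ x≡ ⟩
      ∑ (λ i → λ′ i * w i)
        ≡⟨ ∑-cong (λ i → trans (cong (λ′ i *_) (w≋vg i)) (*-comm _ _)) ⟩
      ∑ (λ i → act v g i * λ′ i)                  ≡⟨ ∑-*-assoc v g λ′ ⟩
      ∑ (λ j → v j * ∑ (λ i → g j i * λ′ i))      ≡⟨ ∑-cong (λ j → *-comm (v j) _) ⟩
      ∑ (λ j → ∑ (λ i → g j i * λ′ i) * v j)      ∎)

  module _ {c} {β : Fin c → Carrier} (β-indep : LinIndepK β) where

    fixes⇒≡I : (X : Fin c → Fin c → Carrier) → InMat₀ X →
      (∀ m → ∑ (λ k → X m k * β k) ≡ β m) → ∀ m k → X m k ≡ I m k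
    fixes⇒≡I X X₀ fixes m k = x∙y⁻¹≈ε⇒x≈y (X m k) (I m k)
      (β-indep (λ k → X m k + - I m k) (λ k → +∈ (X₀ m k) (-∈ (In₀-I m k))) (begin
        ∑ (λ k → (X m k + - I m k) * β k)           ≡⟨ ∑-cong (λ k → distribʳ (β k) _ _) ⟩
        ∑ (λ k → X m k * β k + - I m k * β k)       ≡⟨ ∑-distrib-+ _ (λ k → - I m k * β k) ⟩
        ∑ (λ k → X m k * β k) + ∑ (λ k → - I m k * β k)
          ≡⟨ cong₂ _+_ (fixes m) (∑-cong (λ k → sym (-‿distribˡ-* (I m k) (β k)))) ⟩
        β m + ∑ (λ k → - (I m k * β k))             ≡⟨ cong (β m +_) (sym (-‿distrib-∑ (λ k → I m k * β k))) ⟩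
        β m + - ∑ (λ k → I m k * β k)               ≡⟨ cong (λ t → β m + - t) (∑-Iˡ m β) ⟩
        β m + - β m                                 ≡⟨ -‿inverseʳ (β m) ⟩
        0#                                          ∎) k)

    -- The coordinates of u in β are the columns of an F₀-matrix Λ; the coefficients of β in the
    -- entries of u form an F₀-matrix μ with μ Λ fixing β, hence μ Λ = I and Λ has independent columns.
    coordinates : ∀ {n} {u : Vec n} → (∀ j → InD β (u j)) → (∀ m → InD u (β m)) →
      ∃[ us ] (InU us × u ≋ combo β us)
    coordinates {n} {u} u∈⟨β⟩ β∈Du = us , ((λ k j → Λ₀ j k) , us-indep) , u≋combo
      where
      Λ : Fin n → Fin c → Carrier
      Λ j = proj₁ (u∈⟨β⟩ j)
      Λ₀ : ∀ j k → In₀ (Λ j k)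
      Λ₀ j = proj₁ (proj₂ (u∈⟨β⟩ j))
      u≡Λβ : ∀ j → u j ≡ ∑ (λ k → Λ j k * β k)
      u≡Λβ j = proj₂ (proj₂ (u∈⟨β⟩ j))
      μ : Fin c → Fin n → Carrier
      μ m = proj₁ (β∈Du m)
      μ₀ : ∀ m j → In₀ (μ m j)
      μ₀ m = proj₁ (proj₂ (β∈Du m))
      β≡μu : ∀ m → β m ≡ ∑ (λ j → μ m j * u j)
      β≡μu m = proj₂ (proj₂ (β∈Du m))

      us : Fin c → Vec n
      us k j = Λ j k

      u≋combo : u ≋ combo β us
      u≋combo j = trans (u≡Λβ j) (∑-cong (λ k → *-comm (Λ j k) (β k)))

      μΛ≡I : ∀ m k → ∑ (λ j → μ m j * Λ j k) ≡ I m k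
      μΛ≡I = fixes⇒≡I _ (λ m k → In₀-∑ (λ j → *∈ (μ₀ m j) (Λ₀ j k))) λ m → begin
        ∑ (λ k → ∑ (λ j → μ m j * Λ j k) * β k)   ≡⟨ ∑-*-assoc (μ m) Λ β ⟩
        ∑ (λ j → μ m j * ∑ (λ k → Λ j k * β k))   ≡⟨ ∑-cong (λ j → cong (μ m j *_) (sym (u≡Λβ j))) ⟩
        ∑ (λ j → μ m j * u j)                     ≡⟨ β≡μu m ⟨
        β m                                       ∎

      us-indep : ∀ λ′ → (∀ k → In₀ (λ′ k)) → combo λ′ us ≋ 0V → ∀ k → λ′ k ≡ 0#
      us-indep λ′ _ combo≋0 m = begin
        λ′ m                                       ≡⟨ ∑-Iˡ m λ′ ⟨
        ∑ (λ k → I m k * λ′ k)                     ≡⟨ ∑-cong (λ k → cong (_* λ′ k) (μΛ≡I m k)) ⟨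
        ∑ (λ k → ∑ (λ j → μ m j * Λ j k) * λ′ k)   ≡⟨ ∑-*-assoc (μ m) Λ λ′ ⟩
        ∑ (λ j → μ m j * ∑ (λ k → Λ j k * λ′ k))
          ≡⟨ ∑-zero (λ j → trans (cong (μ m j *_) (Λλ′≡0 j)) (zeroʳ _)) ⟩
        0#                                         ∎
        where
        Λλ′≡0 : ∀ j → ∑ (λ k → Λ j k * λ′ k) ≡ 0#
        Λλ′≡0 j = trans (∑-cong (λ k → *-comm (Λ j k) (λ′ k))) (combo≋0 j)

  InOrbit-inverse : ∀ {n} {v u : Vec n} → InOrbit v u → ∃[ h ] (InMat₀ h × v ≋ act u h)
  InOrbit-inverse {v = v} (g , (_ , h , h₀ , gh≡I , _) , u≋vg) =
    h , h₀ , ≋-trans (≋-sym (act-inverse gh≡I v)) (act-cong h (≋-sym u≋vg))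

  InOrbit⇒SameD : ∀ {n} {v u : Vec n} → InOrbit v u → SameD u v
  InOrbit⇒SameD o@(g , (g₀ , _) , u≋vg) x with InOrbit-inverse o
  ... | h , h₀ , v≋uh = mk⇔ (InD-act g₀ u≋vg) (InD-act h₀ v≋uh)

  InOrbit⇒≢0V : ∀ {n} {v u : Vec n} → ¬ v ≋ 0V → InOrbit v u → ¬ u ≋ 0V
  InOrbit⇒≢0V v≢0 o u≋0 with InOrbit-inverse o
  ... | h , _ , v≋uh = v≢0 (≋-trans v≋uh (≋-trans (act-cong h u≋0) (act-0V h)))

  SameD⇒combo : ∀ {n c} {v u : Vec n} {β : Fin c → Carrier} → IsBasisD v β →
    SameD u v → ∃[ us ] (InU us × u ≋ combo β us)
  SameD⇒combo {u = u} {β} (β∈Dv , β-indep , Dv⊆⟨β⟩) Du=Dv = coordinates β-indep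
    (λ j → Dv⊆⟨β⟩ (u j) (Equivalence.to (Du=Dv (u j)) (InD-entry u j)))
    (λ m → Equivalence.from (Du=Dv (β m)) (β∈Dv m))

  block : ∀ {n} → Carrier → Vec n → Vec n → Mat n → Mat (suc n)
  block a row col M zero    zero    = a
  block a row col M zero    (suc j) = row j
  block a row col M (suc i) zero    = col i
  block a row col M (suc i) (suc j) = M i j

  block₀ : ∀ {n} {a : Carrier} {row col : Vec n} {M : Mat n} →
    In₀ a → InV₀ row → InV₀ col → InMat₀ M → InMat₀ (block a row col M)
  block₀ a₀ row₀ col₀ M₀ zero    zero    = a₀
  block₀ a₀ row₀ col₀ M₀ zero    (suc j) = row₀ j
  block₀ a₀ row₀ col₀ M₀ (suc i) zero    = col₀ i
  block₀ a₀ row₀ col₀ M₀ (suc i) (suc j) = M₀ i j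

  0V∈V₀ : ∀ {n} → InV₀ (0V {n})
  0V∈V₀ _ = 0∈

  lift : ∀ {n} → Mat n → Mat (suc n)
  lift M = block 1# 0V 0V M

  act-lift-head : ∀ {n} (x : Vec (suc n)) (M : Mat n) → act x (lift M) zero ≡ x zero
  act-lift-head x M =
    trans (cong₂ _+_ (*-identityʳ (x zero)) (∑-zero (λ i → zeroʳ (x (suc i))))) (+-identityʳ _)

  act-lift-tail : ∀ {n} (x : Vec (suc n)) (M : Mat n) (j : Fin n) →
    act x (lift M) (suc j) ≡ act (tail x) M j
  act-lift-tail x M j = trans (cong (_+ act (tail x) M j) (zeroʳ (x zero))) (+-identityˡ _)

  lift-inverse : ∀ {n} {M M′ : Mat n} → (∀ y → act (act y M) M′ ≋ y) →
    ∀ x → act (act x (lift M)) (lift M′) ≋ x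
  lift-inverse {M = M} {M′} MM′ x zero    = trans (act-lift-head (act x (lift M)) M′) (act-lift-head x M)
  lift-inverse {M = M} {M′} MM′ x (suc j) = trans (act-lift-tail (act x (lift M)) M′ j)
    (trans (act-cong M′ (act-lift-tail x M) j) (MM′ (tail x) j))

  GL₀-lift : ∀ {n} → GL₀ n → GL₀ (suc n)
  GL₀-lift G = record
    { mat = lift (mat G) ; inv = lift (inv G)
    ; mat₀ = block₀ 1∈ 0V∈V₀ 0V∈V₀ (mat₀ G) ; inv₀ = block₀ 1∈ 0V∈V₀ 0V∈V₀ (inv₀ G)
    ; inverseˡ = lift-inverse (inverseˡ G) ; inverseʳ = lift-inverse (inverseʳ G) }

  column₀ : ∀ {n} → Vec n → Mat (suc n)
  column₀ b = block 1# 0V b I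

  act-column₀-head : ∀ {n} (x : Vec (suc n)) (b : Vec n) →
    act x (column₀ b) zero ≡ x zero + ∑ (λ i → x (suc i) * b i)
  act-column₀-head x b = cong (_+ ∑ (λ i → x (suc i) * b i)) (*-identityʳ (x zero))

  act-column₀-tail : ∀ {n} (x : Vec (suc n)) (b : Vec n) (j : Fin n) → act x (column₀ b) (suc j) ≡ x (suc j)
  act-column₀-tail x b j =
    trans (cong (_+ act (tail x) I j) (zeroʳ (x zero))) (trans (+-identityˡ _) (act-I (tail x) j))

  column₀-inverse : ∀ {n} {b b′ : Vec n} → (∀ i → b′ i ≡ - b i) →
    ∀ x → act (act x (column₀ b)) (column₀ b′) ≋ x
  column₀-inverse {b = b} {b′} b′≡-b x zero = begin
    act (act x (column₀ b)) (column₀ b′) zero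
      ≡⟨ act-column₀-head (act x (column₀ b)) b′ ⟩
    act x (column₀ b) zero + ∑ (λ i → act x (column₀ b) (suc i) * b′ i)
      ≡⟨ cong₂ _+_ (act-column₀-head x b) (∑-cong λ i →
           trans (cong₂ _*_ (act-column₀-tail x b i) (b′≡-b i)) (sym (-‿distribʳ-* _ _))) ⟩
    (x zero + S) + ∑ (λ i → - (x (suc i) * b i))
      ≡⟨ cong ((x zero + S) +_) (sym (-‿distrib-∑ (λ i → x (suc i) * b i))) ⟩
    (x zero + S) + - S
      ≡⟨ +-assoc (x zero) S (- S) ⟩
    x zero + (S + - S)
      ≡⟨ cong (x zero +_) (-‿inverseʳ S) ⟩
    x zero + 0#
      ≡⟨ +-identityʳ (x zero) ⟩
    x zero ∎
    where S = ∑ (λ i → x (suc i) * b i)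
  column₀-inverse {b = b} {b′} _ x (suc j) =
    trans (act-column₀-tail (act x (column₀ b)) b′ j) (act-column₀-tail x b j)

  GL₀-column₀ : ∀ {n} (b : Vec n) → InV₀ b → GL₀ (suc n)
  GL₀-column₀ b b₀ = record
    { mat = column₀ b ; inv = column₀ (λ i → - b i)
    ; mat₀ = block₀ 1∈ 0V∈V₀ b₀ In₀-I ; inv₀ = block₀ 1∈ 0V∈V₀ (λ i → -∈ (b₀ i)) In₀-I
    ; inverseˡ = column₀-inverse (λ i → refl)
    ; inverseʳ = column₀-inverse (λ i → sym (-‿involutive (b i))) }

  row₀ : ∀ {n} → Carrier → Vec n → Mat (suc n)
  row₀ a d = block a d 0V I

  act-row₀-head : ∀ {n} (x : Vec (suc n)) (a : Carrier) (d : Vec n) → act x (row₀ a d) zero ≡ x zero * a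
  act-row₀-head x a d = trans (cong (x zero * a +_) (∑-zero (λ i → zeroʳ (x (suc i))))) (+-identityʳ _)

  act-row₀-tail : ∀ {n} (x : Vec (suc n)) (a : Carrier) (d : Vec n) (j : Fin n) →
    act x (row₀ a d) (suc j) ≡ x zero * d j + x (suc j)
  act-row₀-tail x a d j = cong (x zero * d j +_) (act-I (tail x) j)

  row₀-inverse : ∀ {n} {a a′ : Carrier} {d d′ : Vec n} → a * a′ ≡ 1# → (∀ j → d j + a * d′ j ≡ 0#) →
    ∀ x → act (act x (row₀ a d)) (row₀ a′ d′) ≋ x
  row₀-inverse {a = a} {a′} {d} {d′} aa′≡1 _ x zero = begin
    act (act x (row₀ a d)) (row₀ a′ d′) zero ≡⟨ act-row₀-head (act x (row₀ a d)) a′ d′ ⟩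
    act x (row₀ a d) zero * a′                ≡⟨ cong (_* a′) (act-row₀-head x a d) ⟩
    x zero * a * a′                           ≡⟨ *-assoc (x zero) a a′ ⟩
    x zero * (a * a′)                         ≡⟨ cong (x zero *_) aa′≡1 ⟩
    x zero * 1#                               ≡⟨ *-identityʳ (x zero) ⟩
    x zero                                    ∎
  row₀-inverse {a = a} {a′} {d} {d′} _ d+ad′≡0 x (suc j) = begin
    act (act x (row₀ a d)) (row₀ a′ d′) (suc j)
      ≡⟨ act-row₀-tail (act x (row₀ a d)) a′ d′ j ⟩
    act x (row₀ a d) zero * d′ j + act x (row₀ a d) (suc j)
      ≡⟨ cong₂ _+_ (cong (_* d′ j) (act-row₀-head x a d)) (act-row₀-tail x a d j) ⟩
    x zero * a * d′ j + (x zero * d j + x (suc j))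
      ≡⟨ +-assoc _ _ _ ⟨
    x zero * a * d′ j + x zero * d j + x (suc j)
      ≡⟨ cong (λ t → t + x zero * d j + x (suc j)) (*-assoc (x zero) a (d′ j)) ⟩
    x zero * (a * d′ j) + x zero * d j + x (suc j)
      ≡⟨ cong (_+ x (suc j)) (trans (sym (distribˡ (x zero) _ _)) (cong (x zero *_) (+-comm _ _))) ⟩
    x zero * (d j + a * d′ j) + x (suc j)
      ≡⟨ cong (λ t → x zero * t + x (suc j)) (d+ad′≡0 j) ⟩
    x zero * 0# + x (suc j)
      ≡⟨ cong (_+ x (suc j)) (zeroʳ (x zero)) ⟩
    0# + x (suc j)
      ≡⟨ +-identityˡ (x (suc j)) ⟩
    x (suc j) ∎

  GL₀-row₀ : ∀ {n} (a a′ : Carrier) (d : Vec n) → a * a′ ≡ 1# → In₀ a → In₀ a′ → InV₀ d → GL₀ (suc n)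
  GL₀-row₀ a a′ d aa′≡1 a₀ a′₀ d₀ = record
    { mat = row₀ a d ; inv = row₀ a′ d′
    ; mat₀ = block₀ a₀ d₀ 0V∈V₀ In₀-I ; inv₀ = block₀ a′₀ (λ j → -∈ (*∈ a′₀ (d₀ j))) 0V∈V₀ In₀-I
    ; inverseˡ = row₀-inverse aa′≡1 λ j → begin
        d j + a * - (a′ * d j)   ≡⟨ cong (d j +_) (sym (-‿distribʳ-* a _)) ⟩
        d j + - (a * (a′ * d j)) ≡⟨ cong (λ t → d j + - t) (sym (*-assoc a a′ (d j))) ⟩
        d j + - (a * a′ * d j)   ≡⟨ cong (λ t → d j + - (t * d j)) aa′≡1 ⟩
        d j + - (1# * d j)       ≡⟨ cong (λ t → d j + - t) (*-identityˡ (d j)) ⟩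
        d j + - d j              ≡⟨ -‿inverseʳ (d j) ⟩
        0#                       ∎
    ; inverseʳ = row₀-inverse (trans (*-comm a′ a) aa′≡1) (λ j → -‿inverseˡ (a′ * d j)) }
    where
    d′ : Vec _
    d′ j = - (a′ * d j)

  δ : ∀ {c n} → Fin c → Vec n
  δ zero    zero    = 1#
  δ zero    (suc j) = 0#
  δ (suc k) zero    = 0#
  δ (suc k) (suc j) = δ k j

  In₀-δ : ∀ {c n} (k : Fin c) (j : Fin n) → In₀ (δ k j)
  In₀-δ zero    zero    = 1∈
  In₀-δ zero    (suc j) = 0∈
  In₀-δ (suc k) zero    = 0∈
  In₀-δ (suc k) (suc j) = In₀-δ k j

  δ-orthonormal : ∀ {c n} → c ≤ n → (k k′ : Fin c) → ∑ {n} (λ j → δ k j * δ k′ j) ≡ I k k′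
  δ-orthonormal (s≤s {n = n} _) zero zero =
    trans (cong₂ _+_ (*-identityˡ 1#) (∑-zero {n} (λ j → zeroˡ 0#))) (+-identityʳ 1#)
  δ-orthonormal (s≤s {n = n} _) zero (suc k′) =
    trans (cong₂ _+_ (zeroʳ 1#) (∑-zero {n} (λ j → zeroˡ (δ k′ j)))) (+-identityʳ 0#)
  δ-orthonormal (s≤s {n = n} _) (suc k) zero =
    trans (cong₂ _+_ (zeroˡ 1#) (∑-zero {n} (λ j → zeroʳ (δ k j)))) (+-identityʳ 0#)
  δ-orthonormal (s≤s c≤n) (suc k) (suc k′) =
    trans (cong₂ _+_ (zeroˡ 0#) (δ-orthonormal c≤n k k′)) (+-identityˡ _)

  ∑-δ-combo : ∀ {c n} → c ≤ n → (a : Fin c → Carrier) (k : Fin c) →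
    ∑ {n} (λ i → δ k i * combo a δ i) ≡ a k
  ∑-δ-combo {c} {n} c≤n a k = begin
    ∑ {n} (λ i → δ k i * combo a δ i)
      ≡⟨ ∑-cong {n} (λ i → cong (δ k i *_) (∑-cong (λ k′ → *-comm (a k′) (δ k′ i)))) ⟩
    ∑ {n} (λ i → δ k i * ∑ (λ k′ → δ k′ i * a k′))
      ≡⟨ ∑-*-assoc {n} (δ k) (λ i k′ → δ k′ i) a ⟨
    ∑ (λ k′ → ∑ {n} (λ i → δ k i * δ k′ i) * a k′)
      ≡⟨ ∑-cong (λ k′ → cong (_* a k′) (δ-orthonormal c≤n k k′)) ⟩
    ∑ (λ k′ → I k k′ * a k′)
      ≡⟨ ∑-Iˡ k a ⟩
    a k ∎

  pivot-head : ∀ {n} {x : Vec (suc n)} → InV₀ x → ¬ x zero ≡ 0# →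
    Σ (GL₀ (suc n)) λ G → act x (mat G) ≋ I zero
  pivot-head {n} {x} x∈V₀ x₀≢0 = GL₀-row₀ y (x zero) d yx₀≡1 y∈F₀ (x∈V₀ zero) d∈V₀ , reduced
    where
    y : Carrier
    y = proj₁ (inverse (x zero) x₀≢0)
    x₀y≡1 : x zero * y ≡ 1#
    x₀y≡1 = proj₂ (inverse (x zero) x₀≢0)
    yx₀≡1 : y * x zero ≡ 1#
    yx₀≡1 = trans (*-comm y (x zero)) x₀y≡1
    y∈F₀ : In₀ y
    y∈F₀ = inv∈ (x∈V₀ zero) x₀y≡1
    d : Vec n
    d j = - (x (suc j) * y)
    d∈V₀ : InV₀ d
    d∈V₀ j = -∈ (*∈ (x∈V₀ (suc j)) y∈F₀)
    reduced : act x (row₀ y d) ≋ I zero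
    reduced zero    = trans (act-row₀-head x y d) x₀y≡1
    reduced (suc j) = begin
      act x (row₀ y d) (suc j)                 ≡⟨ act-row₀-tail x y d j ⟩
      x zero * - (x (suc j) * y) + x (suc j)   ≡⟨ cong (_+ x (suc j)) (sym (-‿distribʳ-* _ _)) ⟩
      - (x zero * (x (suc j) * y)) + x (suc j) ≡⟨ cong (λ t → - t + x (suc j)) (x∙yz≈y∙zx _ _ _) ⟩
      - (x (suc j) * (y * x zero)) + x (suc j) ≡⟨ cong (λ t → - (x (suc j) * t) + x (suc j)) yx₀≡1 ⟩
      - (x (suc j) * 1#) + x (suc j)           ≡⟨ cong (λ t → - t + x (suc j)) (*-identityʳ _) ⟩
      - x (suc j) + x (suc j)                  ≡⟨ -‿inverseˡ (x (suc j)) ⟩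
      0#                                       ∎

  InU-act : ∀ {n c} {us : Fin c → Vec n} → InU us → (G : GL₀ n) → InU (λ k → act (us k) (mat G))
  InU-act {us = us} (us∈V₀ , us-indep) G = (λ k → InV₀-act (us∈V₀ k) (mat₀ G)) , λ λ′ λ′₀ combo≋0 →
    us-indep λ′ λ′₀ (≋-trans (≋-sym (inverseˡ G (combo λ′ us)))
      (≋-trans (act-cong (inv G) (≋-trans (act-combo λ′ us (mat G)) combo≋0)) (act-0V (inv G))))

  InU⇒head≢0V : ∀ {n c} {us : Fin (suc c) → Vec n} → InU us → ¬ us zero ≋ 0V
  InU⇒head≢0V {us = us} (_ , us-indep) us₀≋0 = 0≢1 (sym (us-indep (I zero) (In₀-I zero)
    (λ j → trans (∑-Iˡ zero (λ k → us k j)) (us₀≋0 j)) zero))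

  -- A dependency among the minor rows lifts to one among all rows, the head row absorbing
  -- the first column.
  InU-minor : ∀ {n c} {w : Fin (suc c) → Vec (suc n)} → InU w → w zero ≋ I zero →
    InU {n} {c} (λ k j → w (suc k) (suc j))
  InU-minor {n} {c} {w} (w∈V₀ , w-indep) w₀≋I₀ = (λ k j → w∈V₀ (suc k) (suc j)) , λ λ′ λ′₀ combo≋0 k →
    w-indep (extend λ′) (extend₀ λ′₀) (extend-combo λ′ combo≋0) (suc k)
    where
    head : (Fin c → Carrier) → Carrier
    head λ′ = ∑ (λ k → λ′ k * w (suc k) zero)
    extend : (Fin c → Carrier) → Fin (suc c) → Carrier
    extend λ′ zero    = - head λ′
    extend λ′ (suc k) = λ′ k
    extend₀ : ∀ {λ′} → (∀ k → In₀ (λ′ k)) → ∀ k → In₀ (extend λ′ k)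
    extend₀ λ′₀ zero    = -∈ (In₀-∑ (λ k → *∈ (λ′₀ k) (w∈V₀ (suc k) zero)))
    extend₀ λ′₀ (suc k) = λ′₀ k
    extend-combo : ∀ λ′ → combo λ′ (λ k j → w (suc k) (suc j)) ≋ 0V → combo (extend λ′) w ≋ 0V
    extend-combo λ′ _ zero = begin
      - head λ′ * w zero zero + head λ′ ≡⟨ cong (λ t → - head λ′ * t + head λ′) (w₀≋I₀ zero) ⟩
      - head λ′ * 1# + head λ′          ≡⟨ cong (_+ head λ′) (*-identityʳ _) ⟩
      - head λ′ + head λ′               ≡⟨ -‿inverseˡ (head λ′) ⟩
      0#                                ∎
    extend-combo λ′ combo≋0 (suc j) = begin
      - head λ′ * w zero (suc j) + combo λ′ (λ k j → w (suc k) (suc j)) j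
        ≡⟨ cong₂ (λ t s → - head λ′ * t + s) (w₀≋I₀ (suc j)) (combo≋0 j) ⟩
      - head λ′ * 0# + 0#  ≡⟨ cong (_+ 0#) (zeroʳ _) ⟩
      0# + 0#              ≡⟨ +-identityˡ 0# ⟩
      0#                   ∎

  clear-head-column : ∀ {c n} → c ≤ n → (y : Fin (suc c) → Vec (suc n)) → (∀ k → In₀ (y (suc k) zero)) →
    y zero ≋ I zero → (∀ k j → y (suc k) (suc j) ≡ δ k j) →
    Σ (GL₀ (suc n)) λ A → ∀ k → act (y k) (mat A) ≋ δ k
  clear-head-column {c} {n} c≤n y a∈F₀ y₀≋I₀ y≡δ = GL₀-column₀ b b∈V₀ , cleared
    where
    a : Fin c → Carrier
    a k = y (suc k) zero
    b : Vec n
    b j = - combo a δ j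
    b∈V₀ : InV₀ b
    b∈V₀ j = -∈ (In₀-∑ (λ k → *∈ (a∈F₀ k) (In₀-δ k j)))
    cleared : ∀ k → act (y k) (column₀ b) ≋ δ k
    cleared zero zero = begin
      act (y zero) (column₀ b) zero                 ≡⟨ act-column₀-head (y zero) b ⟩
      y zero zero + ∑ (λ i → y zero (suc i) * b i)
        ≡⟨ cong₂ _+_ (y₀≋I₀ zero) (∑-zero (λ i → trans (cong (_* b i) (y₀≋I₀ (suc i))) (zeroˡ (b i)))) ⟩
      1# + 0#                                       ≡⟨ +-identityʳ 1# ⟩
      1#                                            ∎
    cleared zero (suc j) = trans (act-column₀-tail (y zero) b j) (y₀≋I₀ (suc j))
    cleared (suc k) zero = begin
      act (y (suc k)) (column₀ b) zero             ≡⟨ act-column₀-head (y (suc k)) b ⟩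
      a k + ∑ (λ i → y (suc k) (suc i) * b i)
        ≡⟨ cong (a k +_) (∑-cong λ i → trans (cong (_* b i) (y≡δ k i)) (sym (-‿distribʳ-* _ _))) ⟩
      a k + ∑ {n} (λ i → - (δ k i * combo a δ i))
        ≡⟨ cong (a k +_) (sym (-‿distrib-∑ {n} (λ i → δ k i * combo a δ i))) ⟩
      a k + - ∑ {n} (λ i → δ k i * combo a δ i)    ≡⟨ cong (λ t → a k + - t) (∑-δ-combo c≤n a k) ⟩
      a k + - a k                                  ≡⟨ -‿inverseʳ (a k) ⟩
      0#                                           ∎
    cleared (suc k) (suc j) = trans (act-column₀-tail (y (suc k)) b j) (y≡δ k j)

  module _ (_≟_ : DecidableEquality Carrier) where

    pivot : ∀ {n} {x : Vec (suc n)} → InV₀ x → ¬ x ≋ 0V → Σ (GL₀ (suc n)) λ G → act x (mat G) ≋ I zero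
    pivot {n} {x} x∈V₀ x≢0 with ¬∀⟶∃¬-smallest _ (λ i → x i ≡ 0#) (λ i → x i ≟ 0#) x≢0
    ... | zero  , x₀≢0 , _         = pivot-head x∈V₀ x₀≢0
    ... | suc p , xₚ≢0 , earlier≡0 =
      S ⨾ proj₁ pivoted , ≋-trans (act-⨾ x S (proj₁ pivoted)) (proj₂ pivoted)
      where
      S : GL₀ (suc n)
      S = GL₀-column₀ (λ i → I i p) (λ i → In₀-I i p)
      head≡xₚ : act x (mat S) zero ≡ x (suc p)
      head≡xₚ = trans (act-column₀-head x _)
        (trans (cong₂ _+_ (earlier≡0 zero) (∑-Iʳ p (tail x))) (+-identityˡ _))
      pivoted : Σ (GL₀ (suc n)) λ G → act (act x (mat S)) (mat G) ≋ I zero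
      pivoted = pivot-head (InV₀-act x∈V₀ (mat₀ S)) (xₚ≢0 ∘ trans (sym head≡xₚ))

    eliminate : ∀ {c n} (w : Fin c → Vec n) → InU w →
      c ≤ n × Σ (GL₀ n) λ G → ∀ k → act (w k) (mat G) ≋ δ k
    eliminate {zero}          w _   = z≤n , I₀ , λ ()
    eliminate {suc c} {zero}  w w∈U = ⊥-elim (InU⇒head≢0V w∈U (λ ()))
    eliminate {suc c} {suc n} w w∈U = s≤s c≤n , P ⨾ (GL₀-lift R ⨾ A) , reduced
      where
      pivoted : Σ (GL₀ (suc n)) λ G → act (w zero) (mat G) ≋ I zero
      pivoted = pivot (proj₁ w∈U zero) (InU⇒head≢0V w∈U)
      P : GL₀ (suc n)
      P = proj₁ pivoted
      w′ : Fin (suc c) → Vec (suc n)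
      w′ k = act (w k) (mat P)
      w′∈U : InU w′
      w′∈U = InU-act w∈U P
      minor-eliminated : c ≤ n × Σ (GL₀ n) λ G → ∀ k → act (λ j → w′ (suc k) (suc j)) (mat G) ≋ δ k
      minor-eliminated = eliminate (λ k j → w′ (suc k) (suc j)) (InU-minor w′∈U (proj₂ pivoted))
      c≤n : c ≤ n
      c≤n = proj₁ minor-eliminated
      R : GL₀ n
      R = proj₁ (proj₂ minor-eliminated)
      y : Fin (suc c) → Vec (suc n)
      y k = act (w′ k) (lift (mat R))
      y₀≋I₀ : y zero ≋ I zero
      y₀≋I₀ zero    = trans (act-lift-head (w′ zero) (mat R)) (proj₂ pivoted zero)
      y₀≋I₀ (suc j) = trans (act-lift-tail (w′ zero) (mat R) j)
        (trans (act-cong (mat R) (proj₂ pivoted ∘ suc) j) (act-0V (mat R) j))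
      y≡δ : ∀ k j → y (suc k) (suc j) ≡ δ k j
      y≡δ k j = trans (act-lift-tail (w′ (suc k)) (mat R) j) (proj₂ (proj₂ minor-eliminated) k j)
      cleared : Σ (GL₀ (suc n)) λ A → ∀ k → act (y k) (mat A) ≋ δ k
      cleared = clear-head-column c≤n y
        (λ k → InV₀-act (proj₁ w′∈U (suc k)) (mat₀ (GL₀-lift R)) zero) y₀≋I₀ y≡δ
      A : GL₀ (suc n)
      A = proj₁ cleared
      reduced : ∀ k → act (w k) (mat (P ⨾ (GL₀-lift R ⨾ A))) ≋ δ k
      reduced k = ≋-trans (act-⨾ (w k) P (GL₀-lift R ⨾ A))
        (≋-trans (act-⨾ (w′ k) (GL₀-lift R) A) (proj₂ cleared k))

    InU-transitive : ∀ {c n} {us us′ : Fin c → Vec n} → InU us → InU us′ →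
      Σ (GL₀ n) λ G → ∀ k → act (us k) (mat G) ≋ us′ k
    InU-transitive {us = us} {us′} us∈U us′∈U with eliminate us us∈U | eliminate us′ us′∈U
    ... | _ , G , G↦δ | _ , G′ , G′↦δ = G ⨾ G′ ⁻¹ , λ k →
      ≋-trans (act-⨾ (us k) G (G′ ⁻¹))
        (≋-trans (act-cong (inv G′) (≋-trans (G↦δ k) (≋-sym (G′↦δ k)))) (inverseˡ G′ (us′ k)))

    combo⇒InOrbit : ∀ {n c} {v u : Vec n} {β : Fin c → Carrier} → IsBasisD v β →
      ∃[ us ] (InU us × u ≋ combo β us) → InOrbit v u
    combo⇒InOrbit {v = v} {u} {β} basis (us , us∈U , u≋βus)
      with SameD⇒combo basis (λ _ → mk⇔ id id)
    ... | us₀ , us₀∈U , v≋βus₀ with InU-transitive us₀∈U us∈U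
    ... | G , G-moves = mat G , InGL₀-mat G , λ j → begin
      u j                                         ≡⟨ u≋βus j ⟩
      combo β us j                                ≡⟨ ∑-cong (λ k → cong (β k *_) (G-moves k j)) ⟨
      combo β (λ k → act (us₀ k) (mat G)) j       ≡⟨ act-combo β us₀ (mat G) j ⟨
      act (combo β us₀) (mat G) j                 ≡⟨ act-cong (mat G) v≋βus₀ j ⟨
      act v (mat G) j                             ∎

-- Only the finiteness of K (for decidable equality) is used: the description of the orbit holds
-- for any subfield of a finite field and any n.
lemma3p18 : (q q₀ r n : ℕ) → IsPrimePower q → Prime r → q ≡ q₀ ^ r → 2 ≤ n →
    (K : Field) → HasSize K q → (F₀ : Subfield K) → SubHasSize F₀ q₀ →
    let open VectorDefs K F₀ in
    (v : Vec n) → ¬ (v ≋ 0V) →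
    (c : ℕ) (β : Fin c → Field.Carrier K) → IsBasisD v β →
    (u : Vec n) →
      (InOrbit v u ⇔ (∃[ us ] (InU us × u ≋ combo β us)))
      × (InOrbit v u ⇔ (¬ (u ≋ 0V) × SameD u v))
lemma3p18 _ _ _ _ _ _ _ _ K size F₀ _ v v≢0 _ β basis u =
  mk⇔ (SameD⇒combo basis ∘ InOrbit⇒SameD) combo⇒InOrbit′ ,
  mk⇔ (λ o → InOrbit⇒≢0V v≢0 o , InOrbit⇒SameD o) (combo⇒InOrbit′ ∘ SameD⇒combo basis ∘ proj₂)
  where
  open VectorDefs K F₀
  open Orbits K F₀
  combo⇒InOrbit′ : ∃[ us ] (InU us × u ≋ combo β us) → InOrbit v u
  combo⇒InOrbit′ = combo⇒InOrbit (finite⇒decidableEquality K size) basis
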